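{- Let $p$ be an odd prime, $\alpha\in\mathbb{F}_p$ a quadratic non-residue, and $\bar{A}_p=\mathbb{F}_p[i,\epsilon_j,\epsilon_k]$ the finite $\mathbb{F}_p$-algebra with $i^2=\alpha$, $\epsilon_j\epsilon_k=\epsilon_k\epsilon_j=\epsilon_j^2=\epsilon_k^2=0$ and $i\epsilon_j=\epsilon_k=-\epsilon_j i$. Identify $\mathbb{F}_{p^2}$ with the subalgebra $\mathbb{F}_p[i]$, and let $\mathbb{F}_{p^2}^*$ act by conjugation on the nilradical $\mathcal{N}(\bar{A}_p)=\{c\epsilon_j+d\epsilon_k : c,d\in\mathbb{F}_p\}$. Then: (1) for every nonzero $x\in\mathcal{N}(\bar{A}_p)$, the stabilizer of $x$ is $\mathbb{F}_p^*$, and consequently the orbit of $x$ has exactly $p+1$ elements; (2) for all $x_1=c_1\epsilon_j+d_1\epsilon_k$ and $x_2=c_2\epsilon_j+d_2\epsilon_k$ in $\mathcal{N}(\bar{A}_p)$, $x_1$ and $x_2$ lie in the same orbit if and only if $c_1^2-\alpha d_1^2=c_2^2-\alpha d_2^2$. -}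

module Defs where

open import Data.Nat using (ℕ; NonZero) renaming (_+_ to _+ℕ_; _*_ to _*ℕ_; _∸_ to _∸ℕ_)
open import Data.Nat.DivMod using (_mod_)
open import Data.Fin using (Fin; toℕ)
open import Data.Product using (Σ; ∃; _×_; _,_)
open import Relation.Binary.PropositionalEquality using (_≡_)
open import Relation.Nullary using (¬_)

module Fp (p : ℕ) .{{_ : NonZero p}} where

  F : Set
  F = Fin p

  0F 1F : F
  0F = 0 mod p
  1F = 1 mod p

  infixl 6 _+F_ _-F_
  infixl 7 _*F_

  _+F_ : F → F → F
  a +F b = (toℕ a +ℕ toℕ b) mod p

  _*F_ : F → F → F
  a *F b = (toℕ a *ℕ toℕ b) mod p

  -F_ : F → F
  -F a = (p ∸ℕ toℕ a) mod p

  _-F_ : F → F → F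
  a -F b = a +F (-F b)

  NonResidue : F → Set
  NonResidue α = ¬ (Σ F λ x → x *F x ≡ α)

-- The algebra Ā_p = F_p[i, εj, εk] with i² = α, εj εk = εk εj = εj² = εk² = 0,
-- i εj = εk = - εj i.  An element  a + b i + c εj + d εk  is  el a b c d.
module Abar (p : ℕ) .{{_ : NonZero p}} (α : Fin p) where
  open Fp p

  record A : Set where
    constructor el
    field
      re im cj ck : F
  open A public

  zeroA oneA : A
  zeroA = el 0F 0F 0F 0F
  oneA  = el 1F 0F 0F 0F

  -- Multiplication, derived from the defining relations:
  --   i² = α, i εj = εk, εj i = -εk, i εk = α εj, εk i = -α εj, products of ε's vanish.
  infixl 7 _·_
  _·_ : A → A → A
  el a b c d · el a' b' c' d' =
    el (a *F a' +F α *F b *F b')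
       (a *F b' +F b *F a')
       (a *F c' +F α *F b *F d' +F c *F a' -F α *F d *F b')
       (a *F d' +F b *F c' +F d *F a' -F c *F b')

  InFp2 : A → Set
  InFp2 u = (cj u ≡ 0F) × (ck u ≡ 0F)

  InFp2Star : A → Set
  InFp2Star u = InFp2 u × ¬ (u ≡ zeroA)

  InFpStar : A → Set
  InFpStar u = (im u ≡ 0F) × (cj u ≡ 0F) × (ck u ≡ 0F) × ¬ (re u ≡ 0F)

  nil : F → F → A
  nil c d = el 0F 0F c d

  Conj : A → A → A → Set
  Conj u x y = Σ A λ v → InFp2 v × (u · v ≡ oneA) × (v · u ≡ oneA) × (u · x · v ≡ y)

  Stab : A → A → Set
  Stab u x = Conj u x x

  Orbit : A → A → Set
  Orbit x y = Σ A λ u → InFp2Star u × Conj u x y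

  form : F → F → F
  form c d = c *F c -F α *F d *F d

-- Write x = c εj + d εk as x = c + d i ∈ F_{p²} (which is a field because α is a
-- non-residue). Since εj and εk anticommute with i, conjugation by u ∈ F_{p²}^*
-- acts on the nilradical as multiplication by u / ū. By Hilbert 90 these
-- quotients are exactly the norm-one elements, of which there are p + 1, namely
-- 1 and (t + i) / (t - i) for t ∈ F_p. Hence u fixes x ≠ 0 iff u = ū, i.e.
-- u ∈ F_p^*; the orbit of x ≠ 0 is x times the norm-one group; and two elements
-- lie in the same orbit iff they have the same norm c² - α d².
module Submission where

open import Defs
open import Algebra.Bundles using (CommutativeRing; CommutativeSemigroup)
open import Algebra.Structures using (IsCommutativeRing)
open import Algebra.Consequences.Propositional
  using (comm∧idˡ⇒id; comm∧invʳ⇒inv; comm∧distrˡ⇒distrʳ)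
import Algebra.Properties.CommutativeSemigroup as CommutativeSemigroupProperties
import Algebra.Properties.Ring as RingProperties
import Algebra.Properties.Semiring.Mult.TCOptimised as Multiples
open import Algebra.Solver.Ring.AlmostCommutativeRing
  using (fromCommutativeRing; _-Raw-AlmostCommutative⟶_)
import Algebra.Solver.Ring
open import Data.Fin using (Fin; toℕ; _≟_)
open import Data.Fin.Properties using (toℕ-injective; toℕ-fromℕ<; toℕ<n)
open import Data.Integer.Base as ℤ using (ℤ; +_; -[1+_]; _⊖_; _◃_; sign; ∣_∣)
import Data.Integer.Properties as ℤ
open import Data.List using (List; _∷_; length; map; tabulate)
open import Data.List.Properties using (length-map; length-tabulate)
open import Data.List.Membership.Propositional using (_∈_)
open import Data.List.Membership.Propositional.Properties
  using (∈-map⁺; ∈-map⁻; ∈-tabulate⁺; ∈-tabulate⁻)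
open import Data.List.Relation.Unary.Any using (here; there)
import Data.List.Relation.Unary.All.Properties as All
open import Data.List.Relation.Unary.AllPairs using (_∷_)
open import Data.List.Relation.Unary.Unique.Propositional using (Unique)
import Data.List.Relation.Unary.Unique.Propositional.Properties as Unique
import Data.Maybe.Base as Maybe
open import Data.Nat using (ℕ; NonZero; zero; suc; _%_)
open import Data.Nat.DivMod using (_mod_; %-distribˡ-+; %-distribˡ-*; m<n⇒m%n≡m; n%n≡0; m*n%n≡0)
import Data.Nat as ℕ
import Data.Nat.Properties as ℕ
open import Data.Nat.Coprimality using (coprime-Bézout; prime⇒coprime)
open import Data.Nat.GCD using (module Bézout)
open import Data.Nat.Primality using (Prime; prime⇒nonTrivial)
open import Data.Product using (Σ; ∃; _×_; _,_; proj₁; proj₂)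
open import Data.Product.Properties using (,-injectiveˡ; ,-injectiveʳ; ≡-dec)
open import Data.Sign.Base as Sign using (Sign)
open import Function.Bundles using (_⇔_; mk⇔; Equivalence)
open import Level using (0ℓ)
open import Relation.Binary.Consequences using (dec⇒weaklyDec)
open import Relation.Binary.PropositionalEquality using (_≡_)
import Relation.Binary.PropositionalEquality as ≡
open import Relation.Nullary using (¬_; Dec; yes; no; contradiction)

module IntegerCoefficients {c ℓ} (R : CommutativeRing c ℓ) where
  open CommutativeRing R
  open RingProperties ring using (-0#≈0#; -‿involutive; -‿distribˡ-*; -‿distribʳ-*; -‿+-comm)
  open CommutativeSemigroupProperties +-commutativeSemigroup using (interchange)
  open Multiples semiring using (×-homo-+; ×1-homo-*) renaming (_×_ to _×′_)
  open import Relation.Binary.Reasoning.Setoid setoid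

  fromℤ : ℤ → Carrier
  fromℤ (+ n)    = n ×′ 1#
  fromℤ -[1+ n ] = - (suc n ×′ 1#)

  signed : Sign → Carrier → Carrier
  signed Sign.+ x = x
  signed Sign.- x = - x

  signed-cong : ∀ s {x y} → x ≈ y → signed s x ≈ signed s y
  signed-cong Sign.+ x≈y = x≈y
  signed-cong Sign.- x≈y = -‿cong x≈y

  signed-* : ∀ s t x y → signed (s Sign.* t) (x * y) ≈ signed s x * signed t y
  signed-* Sign.+ Sign.+ x y = refl
  signed-* Sign.+ Sign.- x y = -‿distribʳ-* x y
  signed-* Sign.- Sign.+ x y = -‿distribˡ-* x y
  signed-* Sign.- Sign.- x y = begin
    x * y          ≈⟨ -‿involutive (x * y) ⟨
    - - (x * y)    ≈⟨ -‿cong (-‿distribˡ-* x y) ⟩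
    - (- x * y)    ≈⟨ -‿distribʳ-* (- x) y ⟩
    - x * - y      ∎

  fromℤ-◃ : ∀ s n → fromℤ (s ◃ n) ≈ signed s (n ×′ 1#)
  fromℤ-◃ Sign.+ zero    = refl
  fromℤ-◃ Sign.+ (suc n) = refl
  fromℤ-◃ Sign.- zero    = sym -0#≈0#
  fromℤ-◃ Sign.- (suc n) = refl

  fromℤ-signAbs : ∀ i → fromℤ i ≈ signed (sign i) (∣ i ∣ ×′ 1#)
  fromℤ-signAbs i = begin
    fromℤ i                       ≡⟨ ≡.cong fromℤ (ℤ.◃-inverse i) ⟨
    fromℤ (sign i ◃ ∣ i ∣)        ≈⟨ fromℤ-◃ (sign i) ∣ i ∣ ⟩
    signed (sign i) (∣ i ∣ ×′ 1#)  ∎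

  fromℤ-* : ∀ i j → fromℤ (i ℤ.* j) ≈ fromℤ i * fromℤ j
  fromℤ-* i j = begin
    fromℤ (sign i Sign.* sign j ◃ ∣ i ∣ ℕ.* ∣ j ∣)
      ≈⟨ fromℤ-◃ (sign i Sign.* sign j) (∣ i ∣ ℕ.* ∣ j ∣) ⟩
    signed (sign i Sign.* sign j) ((∣ i ∣ ℕ.* ∣ j ∣) ×′ 1#)
      ≈⟨ signed-cong (sign i Sign.* sign j) (×1-homo-* ∣ i ∣ ∣ j ∣) ⟩
    signed (sign i Sign.* sign j) (∣ i ∣ ×′ 1# * ∣ j ∣ ×′ 1#)
      ≈⟨ signed-* (sign i) (sign j) _ _ ⟩
    signed (sign i) (∣ i ∣ ×′ 1#) * signed (sign j) (∣ j ∣ ×′ 1#)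
      ≈⟨ *-cong (fromℤ-signAbs i) (fromℤ-signAbs j) ⟨
    fromℤ i * fromℤ j
      ∎

  +-sub-+ : ∀ x a b → (x + a) - (x + b) ≈ a - b
  +-sub-+ x a b = begin
    (x + a) - (x + b)     ≈⟨ +-congˡ (-‿+-comm x b) ⟨
    (x + a) + (- x - b)   ≈⟨ interchange x a (- x) (- b) ⟩
    (x - x) + (a - b)     ≈⟨ +-congʳ (-‿inverseʳ x) ⟩
    0# + (a - b)          ≈⟨ +-identityˡ (a - b) ⟩
    a - b                 ∎

  fromℤ-⊖ : ∀ m n → fromℤ (m ⊖ n) ≈ m ×′ 1# - n ×′ 1#
  fromℤ-⊖ zero    zero    = sym (-‿inverseʳ 0#)
  fromℤ-⊖ (suc m) zero    = begin
    suc m ×′ 1#            ≈⟨ +-identityʳ (suc m ×′ 1#) ⟨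
    suc m ×′ 1# + 0#       ≈⟨ +-congˡ -0#≈0# ⟨
    suc m ×′ 1# - 0#       ∎
  fromℤ-⊖ zero    (suc n) = sym (+-identityˡ _)
  fromℤ-⊖ (suc m) (suc n) = begin
    fromℤ (suc m ⊖ suc n)           ≡⟨ ≡.cong fromℤ (ℤ.[1+m]⊖[1+n]≡m⊖n m n) ⟩
    fromℤ (m ⊖ n)                   ≈⟨ fromℤ-⊖ m n ⟩
    m ×′ 1# - n ×′ 1#                 ≈⟨ +-sub-+ 1# (m ×′ 1#) (n ×′ 1#) ⟨
    (1# + m ×′ 1#) - (1# + n ×′ 1#)   ≈⟨ +-cong (×-homo-+ 1# 1 m) (-‿cong (×-homo-+ 1# 1 n)) ⟨
    suc m ×′ 1# - suc n ×′ 1#         ∎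

  fromℤ-+ : ∀ i j → fromℤ (i ℤ.+ j) ≈ fromℤ i + fromℤ j
  fromℤ-+ (+ m)    (+ n)    = ×-homo-+ 1# m n
  fromℤ-+ (+ m)    -[1+ n ] = fromℤ-⊖ m (suc n)
  fromℤ-+ -[1+ m ] (+ n)    = trans (fromℤ-⊖ n (suc m)) (+-comm (n ×′ 1#) _)
  fromℤ-+ -[1+ m ] -[1+ n ] = begin
    - (suc (suc (m ℕ.+ n)) ×′ 1#)         ≡⟨ ≡.cong (λ k → - (suc k ×′ 1#)) (ℕ.+-suc m n) ⟨
    - ((suc m ℕ.+ suc n) ×′ 1#)           ≈⟨ -‿cong (×-homo-+ 1# (suc m) (suc n)) ⟩
    - (suc m ×′ 1# + suc n ×′ 1#)          ≈⟨ -‿+-comm (suc m ×′ 1#) (suc n ×′ 1#) ⟨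
    - (suc m ×′ 1#) + - (suc n ×′ 1#)      ∎

  fromℤ-neg : ∀ i → fromℤ (ℤ.- i) ≈ - fromℤ i
  fromℤ-neg (+ zero)  = sym -0#≈0#
  fromℤ-neg (+ suc n) = refl
  fromℤ-neg -[1+ n ]  = sym (-‿involutive _)

  fromℤ-homomorphism : ℤ.+-*-rawRing -Raw-AlmostCommutative⟶ fromCommutativeRing R
  fromℤ-homomorphism = record
    { ⟦_⟧    = fromℤ
    ; +-homo = fromℤ-+
    ; *-homo = fromℤ-*
    ; -‿homo = fromℤ-neg
    ; 0-homo = refl
    ; 1-homo = refl
    }

  -- Normal forms are computed over ℤ, so they are closed terms even when
  -- the arithmetic of R does not compute (as in ℤ/pℤ for a variable p).
  open Algebra.Solver.Ring ℤ.+-*-rawRing (fromCommutativeRing R) fromℤ-homomorphism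
    (λ i j → Maybe.map (λ i≡j → reflexive (≡.cong fromℤ i≡j)) (dec⇒weaklyDec ℤ._≟_ i j)) public

  𝟘 𝟙 : ∀ {n} → Polynomial n
  𝟘 = con (+ 0)
  𝟙 = con (+ 1)

module Residues (p : ℕ) .{{_ : NonZero p}} where
  open Fp p
  open ≡ hiding ([_])
  open ≡-Reasoning

  [_] : ℕ → F
  [ n ] = n mod p

  toℕ-[] : ∀ n → toℕ [ n ] ≡ n % p
  toℕ-[] n = toℕ-fromℕ< _

  toℕ-0F : toℕ 0F ≡ 0
  toℕ-0F = trans (toℕ-[] 0) (m<n⇒m%n≡m (ℕ.>-nonZero⁻¹ p))

  []-cong : ∀ {m n} → m % p ≡ n % p → [ m ] ≡ [ n ]
  []-cong {m} {n} eq = toℕ-injective (trans (toℕ-[] m) (trans eq (sym (toℕ-[] n))))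

  []-injective : ∀ {m n} → m ℕ.< p → n ℕ.< p → [ m ] ≡ [ n ] → m ≡ n
  []-injective {m} {n} m<p n<p eq = begin
    m          ≡⟨ m<n⇒m%n≡m m<p ⟨
    m % p      ≡⟨ toℕ-[] m ⟨
    toℕ [ m ]  ≡⟨ cong toℕ eq ⟩
    toℕ [ n ]  ≡⟨ toℕ-[] n ⟩
    n % p      ≡⟨ m<n⇒m%n≡m n<p ⟩
    n          ∎

  [toℕ] : ∀ a → [ toℕ a ] ≡ a
  [toℕ] a = toℕ-injective (trans (toℕ-[] (toℕ a)) (m<n⇒m%n≡m (toℕ<n a)))

  []-+ : ∀ m n → [ m ] +F [ n ] ≡ [ m ℕ.+ n ]
  []-+ m n = []-cong (begin
    (toℕ [ m ] ℕ.+ toℕ [ n ]) % p  ≡⟨ cong₂ (λ x y → (x ℕ.+ y) % p) (toℕ-[] m) (toℕ-[] n) ⟩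
    (m % p ℕ.+ n % p) % p          ≡⟨ %-distribˡ-+ m n p ⟨
    (m ℕ.+ n) % p                  ∎)

  []-* : ∀ m n → [ m ] *F [ n ] ≡ [ m ℕ.* n ]
  []-* m n = []-cong (begin
    (toℕ [ m ] ℕ.* toℕ [ n ]) % p  ≡⟨ cong₂ (λ x y → (x ℕ.* y) % p) (toℕ-[] m) (toℕ-[] n) ⟩
    (m % p ℕ.* (n % p)) % p        ≡⟨ %-distribˡ-* m n p ⟨
    (m ℕ.* n) % p                  ∎)

  [p]≡0F : [ p ] ≡ 0F
  [p]≡0F = toℕ-injective (trans (toℕ-[] p) (trans (n%n≡0 p) (sym toℕ-0F)))

  [n*a]≡[n]*a : ∀ n a → [ n ℕ.* toℕ a ] ≡ [ n ] *F a
  [n*a]≡[n]*a n a = trans (sym ([]-* n (toℕ a))) (cong ([ n ] *F_) ([toℕ] a))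

  [n*p]≡0F : ∀ n → [ n ℕ.* p ] ≡ 0F
  [n*p]≡0F n = toℕ-injective (trans (toℕ-[] (n ℕ.* p)) (trans (m*n%n≡0 n p) (sym toℕ-0F)))

  lift₁ : ∀ {f g : F → F} → (∀ m → f [ m ] ≡ g [ m ]) → ∀ a → f a ≡ g a
  lift₁ {f} {g} eq a = subst (λ x → f x ≡ g x) ([toℕ] a) (eq (toℕ a))

  lift₃ : ∀ {f g : F → F → F → F} → (∀ m n k → f [ m ] [ n ] [ k ] ≡ g [ m ] [ n ] [ k ])
        → ∀ a b c → f a b c ≡ g a b c
  lift₃ {f} {g} eq a b c
    rewrite sym ([toℕ] a) | sym ([toℕ] b) | sym ([toℕ] c) = eq (toℕ a) (toℕ b) (toℕ c)

  +F-comm : ∀ a b → a +F b ≡ b +F a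
  +F-comm a b = cong [_] (ℕ.+-comm (toℕ a) (toℕ b))

  *F-comm : ∀ a b → a *F b ≡ b *F a
  *F-comm a b = cong [_] (ℕ.*-comm (toℕ a) (toℕ b))

  +F-assoc : ∀ a b c → (a +F b) +F c ≡ a +F (b +F c)
  +F-assoc = lift₃ λ m n k → begin
    ([ m ] +F [ n ]) +F [ k ]  ≡⟨ cong (_+F [ k ]) ([]-+ m n) ⟩
    [ m ℕ.+ n ] +F [ k ]       ≡⟨ []-+ (m ℕ.+ n) k ⟩
    [ m ℕ.+ n ℕ.+ k ]          ≡⟨ cong [_] (ℕ.+-assoc m n k) ⟩
    [ m ℕ.+ (n ℕ.+ k) ]        ≡⟨ []-+ m (n ℕ.+ k) ⟨
    [ m ] +F [ n ℕ.+ k ]       ≡⟨ cong ([ m ] +F_) ([]-+ n k) ⟨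
    [ m ] +F ([ n ] +F [ k ])  ∎

  *F-assoc : ∀ a b c → (a *F b) *F c ≡ a *F (b *F c)
  *F-assoc = lift₃ λ m n k → begin
    ([ m ] *F [ n ]) *F [ k ]  ≡⟨ cong (_*F [ k ]) ([]-* m n) ⟩
    [ m ℕ.* n ] *F [ k ]       ≡⟨ []-* (m ℕ.* n) k ⟩
    [ m ℕ.* n ℕ.* k ]          ≡⟨ cong [_] (ℕ.*-assoc m n k) ⟩
    [ m ℕ.* (n ℕ.* k) ]        ≡⟨ []-* m (n ℕ.* k) ⟨
    [ m ] *F [ n ℕ.* k ]       ≡⟨ cong ([ m ] *F_) ([]-* n k) ⟨
    [ m ] *F ([ n ] *F [ k ])  ∎

  *F-distribˡ-+F : ∀ a b c → a *F (b +F c) ≡ a *F b +F a *F c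
  *F-distribˡ-+F = lift₃ λ m n k → begin
    [ m ] *F ([ n ] +F [ k ])        ≡⟨ cong ([ m ] *F_) ([]-+ n k) ⟩
    [ m ] *F [ n ℕ.+ k ]             ≡⟨ []-* m (n ℕ.+ k) ⟩
    [ m ℕ.* (n ℕ.+ k) ]              ≡⟨ cong [_] (ℕ.*-distribˡ-+ m n k) ⟩
    [ m ℕ.* n ℕ.+ m ℕ.* k ]          ≡⟨ []-+ (m ℕ.* n) (m ℕ.* k) ⟨
    [ m ℕ.* n ] +F [ m ℕ.* k ]       ≡⟨ cong₂ _+F_ ([]-* m n) ([]-* m k) ⟨
    [ m ] *F [ n ] +F [ m ] *F [ k ] ∎

  +F-identityˡ : ∀ a → 0F +F a ≡ a
  +F-identityˡ = lift₁ λ m → []-+ 0 m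

  *F-identityˡ : ∀ a → 1F *F a ≡ a
  *F-identityˡ = lift₁ λ m → trans ([]-* 1 m) (cong [_] (ℕ.*-identityˡ m))

  -F-inverseʳ : ∀ a → a +F -F a ≡ 0F
  -F-inverseʳ a = begin
    a +F [ p ℕ.∸ toℕ a ]              ≡⟨ cong (_+F [ p ℕ.∸ toℕ a ]) ([toℕ] a) ⟨
    [ toℕ a ] +F [ p ℕ.∸ toℕ a ]      ≡⟨ []-+ (toℕ a) (p ℕ.∸ toℕ a) ⟩
    [ toℕ a ℕ.+ (p ℕ.∸ toℕ a) ]       ≡⟨ cong [_] (ℕ.m+[n∸m]≡n (ℕ.<⇒≤ (toℕ<n a))) ⟩
    [ p ]                             ≡⟨ [p]≡0F ⟩
    0F                                ∎

  isCommutativeRing : IsCommutativeRing _≡_ _+F_ _*F_ (λ a → -F a) 0F 1F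
  isCommutativeRing = record
    { isRing = record
      { +-isAbelianGroup = record
        { isGroup = record
          { isMonoid = record
            { isSemigroup = record
              { isMagma = record { isEquivalence = isEquivalence ; ∙-cong = cong₂ _+F_ }
              ; assoc = +F-assoc }
            ; identity = comm∧idˡ⇒id +F-comm +F-identityˡ }
          ; inverse = comm∧invʳ⇒inv +F-comm -F-inverseʳ
          ; ⁻¹-cong = cong (λ a → -F a) }
        ; comm = +F-comm }
      ; *-cong = cong₂ _*F_
      ; *-assoc = *F-assoc
      ; *-identity = comm∧idˡ⇒id *F-comm *F-identityˡ
      ; distrib = *F-distribˡ-+F , comm∧distrˡ⇒distrʳ *F-comm *F-distribˡ-+F }
    ; *-comm = *F-comm }

  commutativeRing : CommutativeRing 0ℓ 0ℓ
  commutativeRing = record { isCommutativeRing = isCommutativeRing }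

module PrimeField (p : ℕ) .{{_ : NonZero p}} (isPrime : Prime p) where
  open Fp p
  open Residues p
  open IntegerCoefficients commutativeRing
  open ≡ hiding ([_])
  open ≡-Reasoning

  1<p : 1 ℕ.< p
  1<p = ℕ.nonTrivial⇒n>1 p {{prime⇒nonTrivial isPrime}}

  1F≢0F : ¬ 1F ≡ 0F
  1F≢0F eq with []-injective 1<p (ℕ.>-nonZero⁻¹ p) eq
  ... | ()

  Bézout⇒inverse : ∀ a → Bézout.Identity 1 p (toℕ a) → ∃ λ b → a *F b ≡ 1F
  Bézout⇒inverse a (Bézout.+- x y eq) = -F [ y ] , (begin
    a *F -F [ y ]                  ≡⟨ solve 2 (λ a y → a :* (:- y) := 𝟙 :- (𝟙 :+ y :* a)) refl a [ y ] ⟩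
    1F -F (1F +F [ y ] *F a)       ≡⟨ cong (λ z → 1F -F (1F +F z)) ([n*a]≡[n]*a y a) ⟨
    1F -F (1F +F [ y ℕ.* toℕ a ])  ≡⟨ cong (λ z → 1F -F z) ([]-+ 1 (y ℕ.* toℕ a)) ⟩
    1F -F [ 1 ℕ.+ y ℕ.* toℕ a ]    ≡⟨ cong (λ n → 1F -F [ n ]) eq ⟩
    1F -F [ x ℕ.* p ]              ≡⟨ cong (λ z → 1F -F z) ([n*p]≡0F x) ⟩
    1F -F 0F                       ≡⟨ solve 0 (𝟙 :- 𝟘 := 𝟙) refl ⟩
    1F                             ∎)
  Bézout⇒inverse a (Bézout.-+ x y eq) = [ y ] , (begin
    a *F [ y ]           ≡⟨ *F-comm a [ y ] ⟩
    [ y ] *F a           ≡⟨ [n*a]≡[n]*a y a ⟨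
    [ y ℕ.* toℕ a ]      ≡⟨ cong [_] eq ⟨
    [ 1 ℕ.+ x ℕ.* p ]    ≡⟨ []-+ 1 (x ℕ.* p) ⟨
    1F +F [ x ℕ.* p ]    ≡⟨ cong (1F +F_) ([n*p]≡0F x) ⟩
    1F +F 0F             ≡⟨ solve 0 (𝟙 :+ 𝟘 := 𝟙) refl ⟩
    1F                   ∎)

  inverse : ∀ {a} → ¬ a ≡ 0F → ∃ λ b → a *F b ≡ 1F
  inverse {a} a≢0 = Bézout⇒inverse a (coprime-Bézout (prime⇒coprime isPrime {{nonZero}} (toℕ<n a)))
    where
    nonZero : NonZero (toℕ a)
    nonZero = ℕ.≢-nonZero λ toℕa≡0 → a≢0 (toℕ-injective (trans toℕa≡0 (sym toℕ-0F)))

  -- 0F ⁻¹ is the junk value 0F.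
  opaque
    _⁻¹ : F → F
    a ⁻¹ with a ≟ 0F
    ... | yes _   = 0F
    ... | no  a≢0 = proj₁ (inverse a≢0)

    *F-inverseʳ : ∀ {a} → ¬ a ≡ 0F → a *F a ⁻¹ ≡ 1F
    *F-inverseʳ {a} a≢0 with a ≟ 0F
    ... | yes a≡0  = contradiction a≡0 a≢0
    ... | no  a≢0′ = proj₂ (inverse a≢0′)

  ⁻¹≢0F : ∀ {a} → ¬ a ≡ 0F → ¬ a ⁻¹ ≡ 0F
  ⁻¹≢0F {a} a≢0 a⁻¹≡0 = 1F≢0F (begin
    1F          ≡⟨ *F-inverseʳ a≢0 ⟨
    a *F a ⁻¹   ≡⟨ cong (a *F_) a⁻¹≡0 ⟩
    a *F 0F     ≡⟨ solve 1 (λ a → a :* 𝟘 := 𝟘) refl a ⟩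
    0F          ∎)

  *F-cancelˡ : ∀ {a b c} → ¬ a ≡ 0F → a *F b ≡ a *F c → b ≡ c
  *F-cancelˡ {a} {b} {c} a≢0 ab≡ac = begin
    b                   ≡⟨ *F-identityˡ b ⟨
    1F *F b             ≡⟨ cong (_*F b) a⁻¹a≡1 ⟨
    a ⁻¹ *F a *F b      ≡⟨ *F-assoc (a ⁻¹) a b ⟩
    a ⁻¹ *F (a *F b)    ≡⟨ cong (a ⁻¹ *F_) ab≡ac ⟩
    a ⁻¹ *F (a *F c)    ≡⟨ *F-assoc (a ⁻¹) a c ⟨
    a ⁻¹ *F a *F c      ≡⟨ cong (_*F c) a⁻¹a≡1 ⟩
    1F *F c             ≡⟨ *F-identityˡ c ⟩
    c                   ∎
    where
    a⁻¹a≡1 : a ⁻¹ *F a ≡ 1F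
    a⁻¹a≡1 = trans (*F-comm (a ⁻¹) a) (*F-inverseʳ a≢0)

  square≡0⇒≡0 : ∀ {a} → a *F a ≡ 0F → a ≡ 0F
  square≡0⇒≡0 {a} aa≡0 with a ≟ 0F
  ... | yes a≡0 = a≡0
  ... | no  a≢0 = *F-cancelˡ a≢0 (trans aa≡0 (solve 1 (λ a → 𝟘 := a :* 𝟘) refl a))

  module Odd (p≢2 : ¬ p ≡ 2) where

    2<p : 2 ℕ.< p
    2<p = ℕ.≤∧≢⇒< 1<p (λ 2≡p → p≢2 (sym 2≡p))

    2F≢0F : ¬ 1F +F 1F ≡ 0F
    2F≢0F eq with []-injective 2<p (ℕ.>-nonZero⁻¹ p) (trans (sym ([]-+ 1 1)) eq)
    ... | ()

    ≡-F⇒≡0F : ∀ {a} → a ≡ -F a → a ≡ 0F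
    ≡-F⇒≡0F {a} a≡-a = *F-cancelˡ 2F≢0F (begin
      (1F +F 1F) *F a    ≡⟨ solve 1 (λ a → (𝟙 :+ 𝟙) :* a := a :+ a) refl a ⟩
      a +F a             ≡⟨ cong (a +F_) a≡-a ⟩
      a +F -F a          ≡⟨ solve 1 (λ a → a :+ :- a := (𝟙 :+ 𝟙) :* 𝟘) refl a ⟩
      (1F +F 1F) *F 0F   ∎)

module QuadraticExtension (p : ℕ) .{{_ : NonZero p}} (α : Fin p) where
  open Fp p
  open Abar p α using (form)
  open Residues p using (commutativeRing)
  open IntegerCoefficients commutativeRing
  open ≡

  K : Set
  K = F × F

  ι : F → K
  ι a = a , 0F

  0K 1K : K
  0K = ι 0F
  1K = ι 1F

  infixl 7 _⊗_
  _⊗_ : K → K → K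
  (a , b) ⊗ (e , f) = a *F e +F α *F b *F f , a *F f +F b *F e

  conj : K → K
  conj (a , b) = a , -F b

  norm : K → F
  norm (c , d) = form c d

  pair≢0K : ∀ {c d} → ¬ (c ≡ 0F × d ≡ 0F) → ¬ (c , d) ≡ 0K
  pair≢0K c,d≢0 c,d≡0 = c,d≢0 (,-injectiveˡ c,d≡0 , ,-injectiveʳ c,d≡0)

  ⊗-comm : ∀ x y → x ⊗ y ≡ y ⊗ x
  ⊗-comm (a , b) (e , f) = cong₂ _,_
    (solve 5 (λ a b e f α → a :* e :+ α :* b :* f := e :* a :+ α :* f :* b) refl a b e f α)
    (solve 4 (λ a b e f → a :* f :+ b :* e := e :* b :+ f :* a) refl a b e f)

  ⊗-assoc : ∀ x y z → (x ⊗ y) ⊗ z ≡ x ⊗ (y ⊗ z)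
  ⊗-assoc (a , b) (c , d) (e , f) = cong₂ _,_
    (solve 7 (λ a b c d e f α →
        (a :* c :+ α :* b :* d) :* e :+ α :* (a :* d :+ b :* c) :* f
      := a :* (c :* e :+ α :* d :* f) :+ α :* b :* (c :* f :+ d :* e)) refl a b c d e f α)
    (solve 7 (λ a b c d e f α →
        (a :* c :+ α :* b :* d) :* f :+ (a :* d :+ b :* c) :* e
      := a :* (c :* f :+ d :* e) :+ b :* (c :* e :+ α :* d :* f)) refl a b c d e f α)

  ⊗-identityˡ : ∀ x → 1K ⊗ x ≡ x
  ⊗-identityˡ (a , b) = cong₂ _,_
    (solve 3 (λ a b α → 𝟙 :* a :+ α :* 𝟘 :* b := a) refl a b α)
    (solve 2 (λ a b → 𝟙 :* b :+ 𝟘 :* a := b) refl a b)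

  ⊗-identityʳ : ∀ x → x ⊗ 1K ≡ x
  ⊗-identityʳ x = trans (⊗-comm x 1K) (⊗-identityˡ x)

  ⊗-zeroˡ : ∀ x → 0K ⊗ x ≡ 0K
  ⊗-zeroˡ (a , b) = cong₂ _,_
    (solve 3 (λ a b α → 𝟘 :* a :+ α :* 𝟘 :* b := 𝟘) refl a b α)
    (solve 2 (λ a b → 𝟘 :* b :+ 𝟘 :* a := 𝟘) refl a b)

  ι-⊗ : ∀ k a b → ι k ⊗ (a , b) ≡ (k *F a , k *F b)
  ι-⊗ k a b = cong₂ _,_
    (solve 4 (λ k a b α → k :* a :+ α :* 𝟘 :* b := k :* a) refl k a b α)
    (solve 3 (λ k a b → k :* b :+ 𝟘 :* a := k :* b) refl k a b)

  ι-⊗-ι : ∀ a b → ι a ⊗ ι b ≡ ι (a *F b)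
  ι-⊗-ι a b = cong₂ _,_
    (solve 3 (λ a b α → a :* b :+ α :* 𝟘 :* 𝟘 := a :* b) refl a b α)
    (solve 2 (λ a b → a :* 𝟘 :+ 𝟘 :* b := 𝟘) refl a b)

  ⊗-commutativeSemigroup : CommutativeSemigroup 0ℓ 0ℓ
  ⊗-commutativeSemigroup = record
    { Carrier = K
    ; _≈_     = _≡_
    ; _∙_     = _⊗_
    ; isCommutativeSemigroup = record
      { isSemigroup = record
        { isMagma = record { isEquivalence = isEquivalence ; ∙-cong = cong₂ _⊗_ }
        ; assoc   = ⊗-assoc }
      ; comm = ⊗-comm }
    }

  conj-involutive : ∀ x → conj (conj x) ≡ x
  conj-involutive (a , b) = cong (a ,_) (solve 1 (λ b → :- (:- b) := b) refl b)

  conj-⊗ : ∀ x y → conj (x ⊗ y) ≡ conj x ⊗ conj y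
  conj-⊗ (a , b) (e , f) = cong₂ _,_
    (solve 5 (λ a b e f α → a :* e :+ α :* b :* f := a :* e :+ α :* (:- b) :* (:- f)) refl a b e f α)
    (solve 4 (λ a b e f → :- (a :* f :+ b :* e) := a :* (:- f) :+ (:- b) :* e) refl a b e f)

  conj-ι : ∀ k → conj (ι k) ≡ ι k
  conj-ι k = cong (k ,_) (solve 0 (:- 𝟘 := 𝟘) refl)

  ⊗-conj : ∀ x → x ⊗ conj x ≡ ι (norm x)
  ⊗-conj (a , b) = cong₂ _,_
    (solve 3 (λ a b α → a :* a :+ α :* b :* (:- b) := a :* a :- α :* b :* b) refl a b α)
    (solve 2 (λ a b → a :* (:- b) :+ b :* a := 𝟘) refl a b)

  norm-⊗ : ∀ x y → norm (x ⊗ y) ≡ norm x *F norm y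
  norm-⊗ (a , b) (e , f) =
    solve 5 (λ a b e f α →
        (a :* e :+ α :* b :* f) :* (a :* e :+ α :* b :* f) :- α :* (a :* f :+ b :* e) :* (a :* f :+ b :* e)
      := (a :* a :- α :* b :* b) :* (e :* e :- α :* f :* f)) refl a b e f α

  norm-conj : ∀ x → norm (conj x) ≡ norm x
  norm-conj (a , b) = solve 3 (λ a b α → a :* a :- α :* (:- b) :* (:- b) := a :* a :- α :* b :* b) refl a b α

  norm-1K : norm 1K ≡ 1F
  norm-1K = solve 1 (λ α → 𝟙 :* 𝟙 :- α :* 𝟘 :* 𝟘 := 𝟙) refl α

  norm-0K : norm 0K ≡ 0F
  norm-0K = solve 1 (λ α → 𝟘 :* 𝟘 :- α :* 𝟘 :* 𝟘 := 𝟘) refl α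

module QuadraticField (p : ℕ) .{{_ : NonZero p}} (isPrime : Prime p)
                      (α : Fin p) (nonResidue : Fp.NonResidue p α) where
  open Fp p
  open Residues p using (commutativeRing; *F-comm)
  open IntegerCoefficients commutativeRing
  open PrimeField p isPrime
  open QuadraticExtension p α
  open CommutativeSemigroupProperties ⊗-commutativeSemigroup using (x∙yz≈y∙xz; xy∙z≈xz∙y)
  open ≡
  open ≡-Reasoning

  _≟K_ : (x y : K) → Dec (x ≡ y)
  _≟K_ = ≡-dec _≟_ _≟_

  norm≡0⇒≡0K : ∀ x → norm x ≡ 0F → x ≡ 0K
  norm≡0⇒≡0K (c , d) N≡0 with d ≟ 0F
  ... | yes refl = cong (_, 0F) (square≡0⇒≡0 (begin
    c *F c                            ≡⟨ solve 2 (λ c α → c :* c := c :* c :- α :* 𝟘 :* 𝟘) refl c α ⟩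
    c *F c -F α *F 0F *F 0F           ≡⟨ N≡0 ⟩
    0F                                ∎))
  ... | no  d≢0 = contradiction (c *F d ⁻¹ , square≡α) nonResidue
    where
    square≡α : (c *F d ⁻¹) *F (c *F d ⁻¹) ≡ α
    square≡α = begin
      (c *F d ⁻¹) *F (c *F d ⁻¹)
        ≡⟨ solve 4 (λ c d d⁻¹ α → (c :* d⁻¹) :* (c :* d⁻¹)
                   := (c :* c :- α :* d :* d) :* (d⁻¹ :* d⁻¹) :+ α :* (d :* d⁻¹) :* (d :* d⁻¹))
                 refl c d (d ⁻¹) α ⟩
      norm (c , d) *F (d ⁻¹ *F d ⁻¹) +F α *F (d *F d ⁻¹) *F (d *F d ⁻¹)
        ≡⟨ cong₂ (λ n e → n *F (d ⁻¹ *F d ⁻¹) +F α *F e *F e) N≡0 (*F-inverseʳ d≢0) ⟩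
      0F *F (d ⁻¹ *F d ⁻¹) +F α *F 1F *F 1F
        ≡⟨ solve 2 (λ x α → 𝟘 :* x :+ α :* 𝟙 :* 𝟙 := α) refl (d ⁻¹ *F d ⁻¹) α ⟩
      α ∎

  norm≢0F : ∀ {x} → ¬ x ≡ 0K → ¬ norm x ≡ 0F
  norm≢0F x≢0 N≡0 = x≢0 (norm≡0⇒≡0K _ N≡0)

  conj≢0K : ∀ {x} → ¬ x ≡ 0K → ¬ conj x ≡ 0K
  conj≢0K {x} x≢0 x̄≡0 = x≢0 (begin
    x               ≡⟨ conj-involutive x ⟨
    conj (conj x)   ≡⟨ cong conj x̄≡0 ⟩
    conj 0K         ≡⟨ conj-ι 0F ⟩
    0K              ∎)

  opaque
    inv : K → K
    inv x = conj x ⊗ ι (norm x ⁻¹)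

    ⊗-inverseʳ : ∀ {x} → ¬ x ≡ 0K → x ⊗ inv x ≡ 1K
    ⊗-inverseʳ {x} x≢0 = begin
      x ⊗ (conj x ⊗ ι (norm x ⁻¹))  ≡⟨ ⊗-assoc x (conj x) (ι (norm x ⁻¹)) ⟨
      x ⊗ conj x ⊗ ι (norm x ⁻¹)    ≡⟨ cong (_⊗ ι (norm x ⁻¹)) (⊗-conj x) ⟩
      ι (norm x) ⊗ ι (norm x ⁻¹)    ≡⟨ ι-⊗-ι (norm x) (norm x ⁻¹) ⟩
      ι (norm x *F norm x ⁻¹)       ≡⟨ cong ι (*F-inverseʳ (norm≢0F x≢0)) ⟩
      1K                            ∎

  ⊗-inverseˡ : ∀ {x} → ¬ x ≡ 0K → inv x ⊗ x ≡ 1K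
  ⊗-inverseˡ {x} x≢0 = trans (⊗-comm (inv x) x) (⊗-inverseʳ x≢0)

  ⊗-cancelˡ : ∀ {x y z} → ¬ x ≡ 0K → x ⊗ y ≡ x ⊗ z → y ≡ z
  ⊗-cancelˡ {x} {y} {z} x≢0 xy≡xz = begin
    y                  ≡⟨ ⊗-identityˡ y ⟨
    1K ⊗ y             ≡⟨ cong (_⊗ y) (⊗-inverseˡ x≢0) ⟨
    inv x ⊗ x ⊗ y      ≡⟨ ⊗-assoc (inv x) x y ⟩
    inv x ⊗ (x ⊗ y)    ≡⟨ cong (inv x ⊗_) xy≡xz ⟩
    inv x ⊗ (x ⊗ z)    ≡⟨ ⊗-assoc (inv x) x z ⟨
    inv x ⊗ x ⊗ z      ≡⟨ cong (_⊗ z) (⊗-inverseˡ x≢0) ⟩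
    1K ⊗ z             ≡⟨ ⊗-identityˡ z ⟩
    z                  ∎

  ⊗-cancelʳ : ∀ {x y z} → ¬ x ≡ 0K → y ⊗ x ≡ z ⊗ x → y ≡ z
  ⊗-cancelʳ {x} {y} {z} x≢0 yx≡zx = ⊗-cancelˡ x≢0 (trans (⊗-comm x y) (trans yx≡zx (⊗-comm z x)))

  ⊗-≢0K : ∀ {x y} → ¬ x ≡ 0K → ¬ y ≡ 0K → ¬ x ⊗ y ≡ 0K
  ⊗-≢0K {x} {y} x≢0 y≢0 xy≡0 = y≢0 (⊗-cancelˡ x≢0 (trans xy≡0 (sym (trans (⊗-comm x 0K) (⊗-zeroˡ x)))))

  -- σ u = u / ū; it is the factor by which u acts on the nilradical.
  opaque
    σ : K → K
    σ u = u ⊗ inv (conj u)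

    σ-⊗-conj : ∀ {u} → ¬ u ≡ 0K → σ u ⊗ conj u ≡ u
    σ-⊗-conj {u} u≢0 = begin
      u ⊗ inv (conj u) ⊗ conj u     ≡⟨ xy∙z≈xz∙y u (inv (conj u)) (conj u) ⟩
      u ⊗ conj u ⊗ inv (conj u)     ≡⟨ ⊗-assoc u (conj u) (inv (conj u)) ⟩
      u ⊗ (conj u ⊗ inv (conj u))   ≡⟨ cong (u ⊗_) (⊗-inverseʳ (conj≢0K u≢0)) ⟩
      u ⊗ 1K                        ≡⟨ ⊗-identityʳ u ⟩
      u                             ∎

  σ≡⇔≡⊗conj : ∀ {u w} → ¬ u ≡ 0K → σ u ≡ w ⇔ u ≡ w ⊗ conj u
  σ≡⇔≡⊗conj {u} {w} u≢0 = mk⇔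
    (λ σu≡w → trans (sym (σ-⊗-conj u≢0)) (cong (_⊗ conj u) σu≡w))
    (λ u≡w⊗ū → ⊗-cancelʳ (conj≢0K u≢0) (trans (σ-⊗-conj u≢0) u≡w⊗ū))

  ⊗≡1K⇒≢0K : ∀ {u v} → u ⊗ v ≡ 1K → ¬ u ≡ 0K
  ⊗≡1K⇒≢0K {u} {v} uv≡1 refl = 1F≢0F (sym (,-injectiveˡ (trans (sym (⊗-zeroˡ v)) uv≡1)))

  ⊗-conj-inverse : ∀ {u v} → u ⊗ v ≡ 1K → u ⊗ conj v ≡ σ u
  ⊗-conj-inverse {u} {v} uv≡1 = sym (Equivalence.from (σ≡⇔≡⊗conj (⊗≡1K⇒≢0K uv≡1)) (sym (begin
    u ⊗ conj v ⊗ conj u      ≡⟨ ⊗-assoc u (conj v) (conj u) ⟩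
    u ⊗ (conj v ⊗ conj u)    ≡⟨ cong (u ⊗_) (trans (sym (conj-⊗ v u)) (cong conj (trans (⊗-comm v u) uv≡1))) ⟩
    u ⊗ conj 1K              ≡⟨ cong (u ⊗_) (conj-ι 1F) ⟩
    u ⊗ 1K                   ≡⟨ ⊗-identityʳ u ⟩
    u                        ∎)))

  σ≡1K⇔≡conj : ∀ {u} → ¬ u ≡ 0K → σ u ≡ 1K ⇔ u ≡ conj u
  σ≡1K⇔≡conj {u} u≢0 = mk⇔
    (λ σu≡1 → trans (Equivalence.to (σ≡⇔≡⊗conj u≢0) σu≡1) (⊗-identityˡ (conj u)))
    (λ u≡ū → Equivalence.from (σ≡⇔≡⊗conj u≢0) (trans u≡ū (sym (⊗-identityˡ (conj u)))))

  norm-σ : ∀ {u} → ¬ u ≡ 0K → norm (σ u) ≡ 1F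
  norm-σ {u} u≢0 = *F-cancelˡ (norm≢0F u≢0) (begin
    norm u *F norm (σ u)         ≡⟨ *F-comm (norm u) (norm (σ u)) ⟩
    norm (σ u) *F norm u         ≡⟨ cong (norm (σ u) *F_) (norm-conj u) ⟨
    norm (σ u) *F norm (conj u)  ≡⟨ norm-⊗ (σ u) (conj u) ⟨
    norm (σ u ⊗ conj u)          ≡⟨ cong norm (σ-⊗-conj u≢0) ⟩
    norm u                       ≡⟨ solve 1 (λ n → n := n :* 𝟙) refl (norm u) ⟩
    norm u *F 1F                 ∎)

  σ-cross : ∀ {u v} → ¬ u ≡ 0K → ¬ v ≡ 0K → σ u ≡ σ v → u ⊗ conj v ≡ v ⊗ conj u
  σ-cross {u} {v} u≢0 v≢0 σu≡σv = begin
    u ⊗ conj v                 ≡⟨ cong (_⊗ conj v) (Equivalence.to (σ≡⇔≡⊗conj u≢0) σu≡σv) ⟩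
    σ v ⊗ conj u ⊗ conj v      ≡⟨ xy∙z≈xz∙y (σ v) (conj u) (conj v) ⟩
    σ v ⊗ conj v ⊗ conj u      ≡⟨ cong (_⊗ conj u) (σ-⊗-conj v≢0) ⟩
    v ⊗ conj u                 ∎

  σ-ι-⊗ : ∀ {k u} → ¬ k ≡ 0F → ¬ u ≡ 0K → σ (ι k ⊗ u) ≡ σ u
  σ-ι-⊗ {k} {u} k≢0 u≢0 = Equivalence.from (σ≡⇔≡⊗conj (⊗-≢0K ιk≢0 u≢0)) (sym (begin
    σ u ⊗ conj (ι k ⊗ u)       ≡⟨ cong (σ u ⊗_) (trans (conj-⊗ (ι k) u) (cong (_⊗ conj u) (conj-ι k))) ⟩
    σ u ⊗ (ι k ⊗ conj u)       ≡⟨ x∙yz≈y∙xz (σ u) (ι k) (conj u) ⟩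
    ι k ⊗ (σ u ⊗ conj u)       ≡⟨ cong (ι k ⊗_) (σ-⊗-conj u≢0) ⟩
    ι k ⊗ u                    ∎))
    where
    ιk≢0 : ¬ ι k ≡ 0K
    ιk≢0 ιk≡0 = k≢0 (,-injectiveˡ ιk≡0)

  [t,1]≢0K : ∀ t → ¬ (t , 1F) ≡ 0K
  [t,1]≢0K t eq = 1F≢0F (,-injectiveʳ eq)

  [1+w]≡w⊗conj[1+w] : ∀ P Q → norm (P , Q) ≡ 1F → (1F +F P , Q) ≡ (P , Q) ⊗ conj (1F +F P , Q)
  [1+w]≡w⊗conj[1+w] P Q N≡1 = cong₂ _,_
    (begin
      1F +F P
        ≡⟨ solve 3 (λ P Q α → 𝟙 :+ P
                             := P :* (𝟙 :+ P) :+ α :* Q :* (:- Q) :+ (𝟙 :- (P :* P :- α :* Q :* Q)))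
                   refl P Q α ⟩
      P *F (1F +F P) +F α *F Q *F (-F Q) +F (1F -F norm (P , Q))
        ≡⟨ cong (λ n → P *F (1F +F P) +F α *F Q *F (-F Q) +F (1F -F n)) N≡1 ⟩
      P *F (1F +F P) +F α *F Q *F (-F Q) +F (1F -F 1F)
        ≡⟨ solve 3 (λ P Q α → P :* (𝟙 :+ P) :+ α :* Q :* (:- Q) :+ (𝟙 :- 𝟙)
                             := P :* (𝟙 :+ P) :+ α :* Q :* (:- Q))
                   refl P Q α ⟩
      P *F (1F +F P) +F α *F Q *F (-F Q)
        ∎)
    (solve 2 (λ P Q → Q := P :* (:- Q) :+ Q :* (𝟙 :+ P)) refl P Q)

  i≡-1⊗conj-i : ∀ P → 1F +F P ≡ 0F → (0F , 1F) ≡ (P , 0F) ⊗ conj (0F , 1F)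
  i≡-1⊗conj-i P 1+P≡0 = cong₂ _,_
    (solve 2 (λ P α → 𝟘 := P :* 𝟘 :+ α :* 𝟘 :* (:- 𝟙)) refl P α)
    (begin
      1F
        ≡⟨ solve 1 (λ P → 𝟙 := P :* (:- 𝟙) :+ 𝟘 :* 𝟘 :+ (𝟙 :+ P)) refl P ⟩
      P *F (-F 1F) +F 0F *F 0F +F (1F +F P)
        ≡⟨ cong (P *F (-F 1F) +F 0F *F 0F +F_) 1+P≡0 ⟩
      P *F (-F 1F) +F 0F *F 0F +F 0F
        ≡⟨ solve 1 (λ P → P :* (:- 𝟙) :+ 𝟘 :* 𝟘 :+ 𝟘 := P :* (:- 𝟙) :+ 𝟘 :* 𝟘) refl P ⟩
      P *F (-F 1F) +F 0F *F 0F
        ∎)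

  -- Hilbert's Theorem 90, with witness u = 1 + w, or u = i when w = -1.
  hilbert90 : ∀ w → norm w ≡ 1F → ∃ λ u → ¬ u ≡ 0K × σ u ≡ w
  hilbert90 (P , Q) N≡1 with (1F +F P , Q) ≟K 0K
  ... | no  u≢0 = (1F +F P , Q) , u≢0 , Equivalence.from (σ≡⇔≡⊗conj u≢0) ([1+w]≡w⊗conj[1+w] P Q N≡1)
  ... | yes u≡0 with ,-injectiveʳ u≡0
  ...   | refl = (0F , 1F) , [t,1]≢0K 0F
                , Equivalence.from (σ≡⇔≡⊗conj ([t,1]≢0K 0F)) (i≡-1⊗conj-i P (,-injectiveˡ u≡0))

  normOnes : List K
  normOnes = 1K ∷ tabulate (λ t → σ (t , 1F))

  length-normOnes : length normOnes ≡ suc p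
  length-normOnes = cong suc (length-tabulate (λ t → σ (t , 1F)))

  ∈⇒norm≡1 : ∀ {w} → w ∈ normOnes → norm w ≡ 1F
  ∈⇒norm≡1 (here refl) = norm-1K
  ∈⇒norm≡1 (there w∈) with ∈-tabulate⁻ w∈
  ... | t , refl = norm-σ ([t,1]≢0K t)

  σ∈normOnes : ∀ u → ¬ u ≡ 0K → σ u ∈ normOnes
  σ∈normOnes (a , b) u≢0 with b ≟ 0F
  ... | yes refl = here (Equivalence.from (σ≡1K⇔≡conj u≢0) (sym (conj-ι a)))
  ... | no  b≢0  = there (subst (_∈ tabulate (λ t → σ (t , 1F))) σ[t,1]≡σu (∈-tabulate⁺ (b ⁻¹ *F a)))
    where
    [t,1]≡ι⊗u : (b ⁻¹ *F a , 1F) ≡ ι (b ⁻¹) ⊗ (a , b)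
    [t,1]≡ι⊗u = sym (trans (ι-⊗ (b ⁻¹) a b)
                           (cong (b ⁻¹ *F a ,_) (trans (*F-comm (b ⁻¹) b) (*F-inverseʳ b≢0))))

    σ[t,1]≡σu : σ (b ⁻¹ *F a , 1F) ≡ σ (a , b)
    σ[t,1]≡σu = trans (cong σ [t,1]≡ι⊗u) (σ-ι-⊗ (⁻¹≢0F b≢0) u≢0)

  norm≡1⇒∈ : ∀ {w} → norm w ≡ 1F → w ∈ normOnes
  norm≡1⇒∈ {w} N≡1 with hilbert90 w N≡1
  ... | u , u≢0 , σu≡w = subst (_∈ normOnes) σu≡w (σ∈normOnes u u≢0)

  ∈normOnes⇔ : ∀ {w} → w ∈ normOnes ⇔ norm w ≡ 1F
  ∈normOnes⇔ = mk⇔ ∈⇒norm≡1 norm≡1⇒∈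

  module _ (p≢2 : ¬ p ≡ 2) where
    open PrimeField.Odd p isPrime p≢2

    σ[t,1]≢1K : ∀ t → ¬ σ (t , 1F) ≡ 1K
    σ[t,1]≢1K t σ≡1 = 1F≢0F (≡-F⇒≡0F (,-injectiveʳ (Equivalence.to (σ≡1K⇔≡conj ([t,1]≢0K t)) σ≡1)))

    σ[t,1]-injective : ∀ {t s} → σ (t , 1F) ≡ σ (s , 1F) → t ≡ s
    σ[t,1]-injective {t} {s} σ≡σ = sym (begin
      s                ≡⟨ solve 2 (λ s t → s := (s :- t) :+ t) refl s t ⟩
      (s -F t) +F t    ≡⟨ cong (_+F t) (≡-F⇒≡0F s-t≡-[s-t]) ⟩
      0F +F t          ≡⟨ solve 1 (λ t → 𝟘 :+ t := t) refl t ⟩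
      t                ∎)
      where
      s-t≡-[s-t] : s -F t ≡ -F (s -F t)
      s-t≡-[s-t] = begin
        s -F t                     ≡⟨ solve 2 (λ t s → s :- t := t :* (:- 𝟙) :+ 𝟙 :* s) refl t s ⟩
        t *F (-F 1F) +F 1F *F s    ≡⟨ ,-injectiveʳ (σ-cross ([t,1]≢0K t) ([t,1]≢0K s) σ≡σ) ⟩
        s *F (-F 1F) +F 1F *F t    ≡⟨ solve 2 (λ t s → s :* (:- 𝟙) :+ 𝟙 :* t := :- (s :- t)) refl t s ⟩
        -F (s -F t)                ∎

    normOnes-unique : Unique normOnes
    normOnes-unique = All.tabulate⁺ (λ t 1≡σ → σ[t,1]≢1K t (sym 1≡σ)) ∷ Unique.tabulate⁺ σ[t,1]-injective

module NilradicalAction (p : ℕ) .{{_ : NonZero p}} (isPrime : Prime p)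
                        (α : Fin p) (nonResidue : Fp.NonResidue p α) where
  open Fp p
  open Abar p α
  open Residues p using (commutativeRing)
  open IntegerCoefficients commutativeRing
  open PrimeField p isPrime using (1F≢0F)
  open QuadraticExtension p α
  open QuadraticField p isPrime α nonResidue
  open CommutativeSemigroupProperties ⊗-commutativeSemigroup using (xy∙z≈y∙xz)
  open ≡
  open ≡-Reasoning

  fp2 : K → A
  fp2 (a , b) = el a b 0F 0F

  nilK : K → A
  nilK (c , d) = nil c d

  fp2-injective : ∀ {u v} → fp2 u ≡ fp2 v → u ≡ v
  fp2-injective eq = cong₂ _,_ (cong re eq) (cong im eq)

  nilK-injective : ∀ {x y} → nilK x ≡ nilK y → x ≡ y
  nilK-injective eq = cong₂ _,_ (cong cj eq) (cong ck eq)

  el-cong : ∀ {a b c d a′ b′ c′ d′} → a ≡ a′ → b ≡ b′ → c ≡ c′ → d ≡ d′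
          → el a b c d ≡ el a′ b′ c′ d′
  el-cong refl refl refl refl = refl

  fp2-· : ∀ u v → fp2 u · fp2 v ≡ fp2 (u ⊗ v)
  fp2-· (a , b) (e , f) = cong₂ (el _ _)
    (solve 5 (λ a b e f α → a :* 𝟘 :+ α :* b :* 𝟘 :+ 𝟘 :* e :- α :* 𝟘 :* f
                           := 𝟘) refl a b e f α)
    (solve 4 (λ a b e f → a :* 𝟘 :+ b :* 𝟘 :+ 𝟘 :* e :- 𝟘 :* f
                         := 𝟘) refl a b e f)

  fp2-·-nilK : ∀ u x → fp2 u · nilK x ≡ nilK (u ⊗ x)
  fp2-·-nilK (a , b) (c , d) = el-cong
    (solve 3 (λ a b α → a :* 𝟘 :+ α :* b :* 𝟘 := 𝟘) refl a b α)
    (solve 2 (λ a b → a :* 𝟘 :+ b :* 𝟘 := 𝟘) refl a b)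
    (solve 5 (λ a b c d α → a :* c :+ α :* b :* d :+ 𝟘 :* 𝟘 :- α :* 𝟘 :* 𝟘
                           := a :* c :+ α :* b :* d) refl a b c d α)
    (solve 4 (λ a b c d → a :* d :+ b :* c :+ 𝟘 :* 𝟘 :- 𝟘 :* 𝟘
                         := a :* d :+ b :* c) refl a b c d)

  nilK-·-fp2 : ∀ x v → nilK x · fp2 v ≡ nilK (x ⊗ conj v)
  nilK-·-fp2 (c , d) (e , f) = el-cong
    (solve 3 (λ e f α → 𝟘 :* e :+ α :* 𝟘 :* f := 𝟘) refl e f α)
    (solve 2 (λ e f → 𝟘 :* f :+ 𝟘 :* e := 𝟘) refl e f)
    (solve 5 (λ c d e f α → 𝟘 :* 𝟘 :+ α :* 𝟘 :* 𝟘 :+ c :* e :- α :* d :* f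
                           := c :* e :+ α :* d :* (:- f)) refl c d e f α)
    (solve 4 (λ c d e f → 𝟘 :* 𝟘 :+ 𝟘 :* 𝟘 :+ d :* e :- c :* f
                         := c :* (:- f) :+ d :* e) refl c d e f)

  conjugate-nilK : ∀ u x v → fp2 u · nilK x · fp2 v ≡ nilK (x ⊗ (u ⊗ conj v))
  conjugate-nilK u x v = begin
    fp2 u · nilK x · fp2 v     ≡⟨ cong (_· fp2 v) (fp2-·-nilK u x) ⟩
    nilK (u ⊗ x) · fp2 v       ≡⟨ nilK-·-fp2 (u ⊗ x) v ⟩
    nilK (u ⊗ x ⊗ conj v)      ≡⟨ cong nilK (xy∙z≈y∙xz u x (conj v)) ⟩
    nilK (x ⊗ (u ⊗ conj v))    ∎

  Conj⇒≡nilK-⊗σ : ∀ {u x y} → Conj (fp2 u) (nilK x) y → y ≡ nilK (x ⊗ σ u)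
  Conj⇒≡nilK-⊗σ {u} {x} {y} (el e f _ _ , (refl , refl) , uv≡1 , _ , uxv≡y) = begin
    y                                ≡⟨ uxv≡y ⟨
    fp2 u · nilK x · fp2 (e , f)     ≡⟨ conjugate-nilK u x (e , f) ⟩
    nilK (x ⊗ (u ⊗ conj (e , f)))    ≡⟨ cong (λ w → nilK (x ⊗ w)) (⊗-conj-inverse u⊗v≡1) ⟩
    nilK (x ⊗ σ u)                   ∎
    where
    u⊗v≡1 : u ⊗ (e , f) ≡ 1K
    u⊗v≡1 = fp2-injective (trans (sym (fp2-· u (e , f))) uv≡1)

  ≢0K⇒Conj : ∀ {u} x → ¬ u ≡ 0K → Conj (fp2 u) (nilK x) (nilK (x ⊗ σ u))
  ≢0K⇒Conj {u} x u≢0 = fp2 (inv u) , (refl , refl)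
    , trans (fp2-· u (inv u)) (cong fp2 (⊗-inverseʳ u≢0))
    , trans (fp2-· (inv u) u) (cong fp2 (⊗-inverseˡ u≢0))
    , trans (conjugate-nilK u x (inv u)) (cong (λ w → nilK (x ⊗ w)) (⊗-conj-inverse (⊗-inverseʳ u≢0)))

  Orbit⇔∃norm≡1 : ∀ {x y} → Orbit (nilK x) y ⇔ ∃ λ w → norm w ≡ 1F × y ≡ nilK (x ⊗ w)
  Orbit⇔∃norm≡1 {x} {y} = mk⇔ to from
    where
    to : Orbit (nilK x) y → ∃ λ w → norm w ≡ 1F × y ≡ nilK (x ⊗ w)
    to (el a b _ _ , ((refl , refl) , u≢0) , conj) =
      σ (a , b) , norm-σ (λ u≡0 → u≢0 (cong fp2 u≡0)) , Conj⇒≡nilK-⊗σ conj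

    from : (∃ λ w → norm w ≡ 1F × y ≡ nilK (x ⊗ w)) → Orbit (nilK x) y
    from (w , N≡1 , y≡) = orbit-σ (hilbert90 w N≡1)
      where
      orbit-σ : (∃ λ u → ¬ u ≡ 0K × σ u ≡ w) → Orbit (nilK x) y
      orbit-σ (u , u≢0 , σu≡w) = fp2 u , ((refl , refl) , λ u≡0 → u≢0 (fp2-injective u≡0))
        , subst (Conj (fp2 u) (nilK x))
                (trans (cong (λ w → nilK (x ⊗ w)) σu≡w) (sym y≡)) (≢0K⇒Conj x u≢0)

  norm-⊗-normOne : ∀ x {w} → norm w ≡ 1F → norm (x ⊗ w) ≡ norm x
  norm-⊗-normOne x {w} N≡1 = begin
    norm (x ⊗ w)        ≡⟨ norm-⊗ x w ⟩
    norm x *F norm w    ≡⟨ cong (norm x *F_) N≡1 ⟩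
    norm x *F 1F        ≡⟨ solve 1 (λ n → n :* 𝟙 := n) refl (norm x) ⟩
    norm x              ∎

  orbit⇔norm≡ : ∀ x y → Orbit (nilK x) (nilK y) ⇔ norm x ≡ norm y
  orbit⇔norm≡ x y = mk⇔
    (λ orbit → let w , N≡1 , y≡ = Equivalence.to Orbit⇔∃norm≡1 orbit in
      trans (sym (norm-⊗-normOne x N≡1)) (cong norm (sym (nilK-injective y≡))))
    (λ Nx≡Ny → Equivalence.from Orbit⇔∃norm≡1 (multiplier Nx≡Ny (x ≟K 0K)))
    where
    multiplier : norm x ≡ norm y → Dec (x ≡ 0K) → ∃ λ w → norm w ≡ 1F × nilK y ≡ nilK (x ⊗ w)
    multiplier Nx≡Ny (yes refl) = 1K , norm-1K , cong nilK (begin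
      y          ≡⟨ norm≡0⇒≡0K y (trans (sym Nx≡Ny) norm-0K) ⟩
      0K         ≡⟨ ⊗-identityʳ 0K ⟨
      0K ⊗ 1K    ∎)
    multiplier Nx≡Ny (no x≢0) = inv x ⊗ y , norm≡1 , cong nilK (begin
      y                  ≡⟨ ⊗-identityˡ y ⟨
      1K ⊗ y             ≡⟨ cong (_⊗ y) (⊗-inverseʳ x≢0) ⟨
      x ⊗ inv x ⊗ y      ≡⟨ ⊗-assoc x (inv x) y ⟩
      x ⊗ (inv x ⊗ y)    ∎)
      where
      norm≡1 : norm (inv x ⊗ y) ≡ 1F
      norm≡1 = begin
        norm (inv x ⊗ y)          ≡⟨ norm-⊗ (inv x) y ⟩
        norm (inv x) *F norm y    ≡⟨ cong (norm (inv x) *F_) Nx≡Ny ⟨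
        norm (inv x) *F norm x    ≡⟨ norm-⊗ (inv x) x ⟨
        norm (inv x ⊗ x)          ≡⟨ cong norm (⊗-inverseˡ x≢0) ⟩
        norm 1K                   ≡⟨ norm-1K ⟩
        1F                        ∎

  orbitList : K → List A
  orbitList x = map (λ w → nilK (x ⊗ w)) normOnes

  length-orbitList : ∀ x → length (orbitList x) ≡ suc p
  length-orbitList x = trans (length-map (λ w → nilK (x ⊗ w)) normOnes) length-normOnes

  ∈orbitList⇔Orbit : ∀ {x y} → y ∈ orbitList x ⇔ Orbit (nilK x) y
  ∈orbitList⇔Orbit {x} {y} = mk⇔
    (λ y∈ → let w , w∈ , y≡ = ∈-map⁻ (λ w → nilK (x ⊗ w)) y∈ in
      Equivalence.from Orbit⇔∃norm≡1 (w , Equivalence.to ∈normOnes⇔ w∈ , y≡))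
    (λ orbit → let w , N≡1 , y≡ = Equivalence.to Orbit⇔∃norm≡1 orbit in
      subst (_∈ orbitList x) (sym y≡) (∈-map⁺ (λ w → nilK (x ⊗ w)) (Equivalence.from ∈normOnes⇔ N≡1)))

  module _ (p≢2 : ¬ p ≡ 2) where
    open PrimeField.Odd p isPrime p≢2 using (≡-F⇒≡0F)

    stabilizer⇔InFpStar : ∀ {x} → ¬ x ≡ 0K → ∀ u → InFp2Star u → Stab u (nilK x) ⇔ InFpStar u
    stabilizer⇔InFpStar {x} x≢0 (el a b _ _) ((refl , refl) , u≢0) = mk⇔ to from
      where
      u≢0K : ¬ (a , b) ≡ 0K
      u≢0K u≡0 = u≢0 (cong fp2 u≡0)

      to : Stab (fp2 (a , b)) (nilK x) → InFpStar (fp2 (a , b))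
      to stab = b≡0 , refl , refl , λ a≡0 → u≢0K (cong₂ _,_ a≡0 b≡0)
        where
        σu≡1 : σ (a , b) ≡ 1K
        σu≡1 = ⊗-cancelˡ x≢0 (trans (sym (nilK-injective (Conj⇒≡nilK-⊗σ stab))) (sym (⊗-identityʳ x)))
        b≡0 : b ≡ 0F
        b≡0 = ≡-F⇒≡0F (,-injectiveʳ (Equivalence.to (σ≡1K⇔≡conj u≢0K) σu≡1))

      from : InFpStar (fp2 (a , b)) → Stab (fp2 (a , b)) (nilK x)
      from (refl , _) = subst (Conj (fp2 (a , 0F)) (nilK x))
                          (cong nilK (trans (cong (x ⊗_) σu≡1) (⊗-identityʳ x))) (≢0K⇒Conj x u≢0K)
        where
        σu≡1 : σ (a , 0F) ≡ 1K
        σu≡1 = Equivalence.from (σ≡1K⇔≡conj u≢0K) (sym (conj-ι a))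

    orbitList-unique : ∀ {x} → ¬ x ≡ 0K → Unique (orbitList x)
    orbitList-unique x≢0 = Unique.map⁺ (λ eq → ⊗-cancelˡ x≢0 (nilK-injective eq)) (normOnes-unique p≢2)

lemma3p4p1 : (p : ℕ) .{{_ : NonZero p}} → Prime p → ¬ (p ≡ 2)
    → (α : Fin p) → Fp.NonResidue p α
    → ((c d : Fin p) → ¬ ((c ≡ Fp.0F p) × (d ≡ Fp.0F p))
        → ((u : Abar.A p α) → Abar.InFp2Star p α u
            → (Abar.Stab p α u (Abar.nil p α c d) ⇔ Abar.InFpStar p α u))
          × Σ (List (Abar.A p α)) (λ ys → (length ys ≡ suc p) × Unique ys
              × ((y : Abar.A p α) → (y ∈ ys) ⇔ Abar.Orbit p α (Abar.nil p α c d) y)))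
      × ((c₁ d₁ c₂ d₂ : Fin p)
        → Abar.Orbit p α (Abar.nil p α c₁ d₁) (Abar.nil p α c₂ d₂)
          ⇔ (Abar.form p α c₁ d₁ ≡ Abar.form p α c₂ d₂))
lemma3p4p1 p isPrime p≢2 α nonResidue =
  (λ c d c,d≢0 →
      stabilizer⇔InFpStar p≢2 (pair≢0K c,d≢0)
    , orbitList (c , d) , length-orbitList (c , d) , orbitList-unique p≢2 (pair≢0K c,d≢0)
    , λ y → ∈orbitList⇔Orbit)
  , λ c₁ d₁ c₂ d₂ → orbit⇔norm≡ (c₁ , d₁) (c₂ , d₂)
  where
  open QuadraticExtension p α using (pair≢0K)
  open NilradicalAction p isPrime α nonResidue
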